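{- Let $G$ be a graph of maximum degree $\Delta\ge 2$. Then every graph obtained from $G$ by applying $t\ge 0$ labeled contractions has maximum degree at most $\Delta+t(\Delta-2)$. Moreover, this bound is tight: for every $t\ge 0$ (and $\Delta\ge 2$) there exist a graph $G$ of maximum degree $\Delta$ and a sequence of $t$ labeled contractions on $G$ resulting in a graph of maximum degree $\Delta+t(\Delta-2)$.
   Context: Graphs are finite, simple and undirected. For an edge $uv$ of $G$, the labeled contraction $(u,v)$ yields $G/(u,v)$: add an edge between $u$ and every vertex of $N_G(v)\setminus N_G[u]$, then delete $v$; contractions are applied successively, each to an edge of the current graph. -}

module Defs where

open import Data.Nat using (ℕ; zero; suc; _+_; _⊔_)
open import Data.Bool using (Bool; true; false; _∨_; _∧_; not; if_then_else_)
open import Data.Fin using (Fin; punchIn; _≟_)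
open import Data.List using (List; map; foldr; allFin)
open import Data.Nat.ListAction using (sum)
open import Relation.Nullary.Decidable using (⌊_⌋; yes; no)
open import Relation.Binary.PropositionalEquality using (_≡_; refl)

record Graph (n : ℕ) : Set where
  field
    adj    : Fin n → Fin n → Bool
    sym    : ∀ x y → adj x y ≡ adj y x
    irrefl : ∀ x → adj x x ≡ false
open Graph public

deg : ∀ {n} → Graph n → Fin n → ℕ
deg {n} G u = sum (map (λ w → if adj G u w then 1 else 0) (allFin n))

maxDeg : ∀ {n} → Graph n → ℕ
maxDeg {n} G = foldr _⊔_ 0 (map (deg G) (allFin n))

-- Labeled contraction (u , v) on a graph with vertex set Fin (suc n).
-- The deleted vertex is v; the surviving vertices are indexed by Fin n via
-- punchIn v, and u = punchIn v u'.  In the result, u' is additionally joined to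
-- every vertex of N(v) \ N[u]; all other adjacencies are inherited.
private
  extra : ∀ {n} → (G : Graph (suc n)) (v : Fin (suc n)) (u' : Fin n) →
          Fin n → Fin n → Bool
  extra G v u' x y = ⌊ x ≟ u' ⌋ ∧ (not ⌊ y ≟ u' ⌋ ∧ adj G v (punchIn v y))

  cadj : ∀ {n} → (G : Graph (suc n)) (v : Fin (suc n)) (u' : Fin n) →
         Fin n → Fin n → Bool
  cadj G v u' x y =
    adj G (punchIn v x) (punchIn v y) ∨ (extra G v u' x y ∨ extra G v u' y x)

  ∨-swap : ∀ a b c → a ∨ (b ∨ c) ≡ a ∨ (c ∨ b)
  ∨-swap false false false = refl
  ∨-swap false false true = refl
  ∨-swap false true false = refl
  ∨-swap false true true = refl
  ∨-swap true b c = refl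

  csym : ∀ {n} (G : Graph (suc n)) v u' x y → cadj G v u' x y ≡ cadj G v u' y x
  csym G v u' x y rewrite sym G (punchIn v x) (punchIn v y) =
    ∨-swap (adj G (punchIn v y) (punchIn v x)) (extra G v u' x y) (extra G v u' y x)

  ex-irr : ∀ {n} (G : Graph (suc n)) v u' x → extra G v u' x x ≡ false
  ex-irr G v u' x with x ≟ u'
  ... | yes _ = refl
  ... | no _ = refl

  cirr : ∀ {n} (G : Graph (suc n)) v u' x → cadj G v u' x x ≡ false
  cirr G v u' x rewrite irrefl G (punchIn v x) | ex-irr G v u' x = refl

contract : ∀ {n} → Graph (suc n) → (v : Fin (suc n)) → (u' : Fin n) → Graph n
contract G v u' = record { adj = cadj G v u' ; sym = csym G v u' ; irrefl = cirr G v u' }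

data Contractions : ∀ {n m} → Graph n → ℕ → Graph m → Set where
  done : ∀ {n} {G : Graph n} → Contractions G 0 G
  step : ∀ {n m t} {G : Graph (suc n)} {H : Graph m} (v : Fin (suc n)) (u' : Fin n) →
         adj G (punchIn v u') v ≡ true →
         Contractions (contract G v u') t H →
         Contractions G (suc t) H

module Submission where

-- Upper bound: measure a graph by its excess ∑ₓ (deg x ∸ Δ). Contracting uv produces a
-- vertex of degree at most deg u + deg v − 2 and raises no other degree, so every
-- contraction increases the excess by at most Δ − 2; as each degree is at most Δ plus the
-- excess, t contractions leave the maximum degree at most Δ + t(Δ − 2).
-- Tightness: a caterpillar with spine 0 − 1 − ⋯ − t in which every spine vertex has degree Δ
-- contracts, edge by edge along the spine, into a vertex adjacent to all Δ + t(Δ − 2) leaves.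

open import Defs hiding (sym)
open import Algebra.Properties.CommutativeMonoid.Sum as Sum using ()
open import Data.Bool using (Bool; true; false; T; _∨_; if_then_else_)
open import Data.Bool.Properties using (∨-identityʳ; ∨-zeroʳ; T-≡)
open import Data.Fin using (Fin; zero; suc; punchIn; toℕ; _≟_)
open import Data.Fin.Properties using (punchInᵢ≢i; toℕ<n)
open import Data.List using (foldr; tabulate)
open import Data.List.Properties using (map-tabulate)
open import Data.Nat using (ℕ; zero; suc; pred; _+_; _*_; _∸_; _⊔_; _<ᵇ_; _<?_)
open import Data.Nat using (_≤_; _<_; z≤n; s≤s; z<s; s<s; s<s⁻¹)
open import Data.Nat.ListAction using () renaming (sum to sumList)
open import Data.Nat.Properties hiding (_≟_)
open import Data.Nat.Properties using () renaming (_≟_ to _≟ℕ_)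
open import Data.Nat.Tactic.RingSolver using (solve-∀)
open import Data.Product using (Σ; ∃; _×_; _,_)
open import Data.Sum using (_⊎_; inj₁; inj₂; [_,_]; swap)
open import Function using (_∘_; id)
open import Function.Bundles using (mk⇔; Equivalence)
open import Relation.Binary.PropositionalEquality hiding ([_])
open import Relation.Nullary using (¬_; Dec; yes; no)
open import Relation.Nullary.Decidable using (⌊_⌋; does; isYes≗does; dec-true; dec-false; does-⇔; _×-dec_; _⊎-dec_)
open import Relation.Unary using (Decidable)

open Sum +-0-commutativeMonoid using (sum-remove; sum-cong-≗; sum-replicate-zero; ∑-distrib-+) renaming (sum to ∑)

ind : Bool → ℕ
ind b = if b then 1 else 0

ind-∨ : ∀ a b → ind (a ∨ b) ≤ ind a + ind b
ind-∨ true b = s≤s z≤n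
ind-∨ false b = ≤-refl

⌊⌋-true : ∀ {A : Set} (a? : Dec A) → A → ⌊ a? ⌋ ≡ true
⌊⌋-true a? a = trans (isYes≗does a?) (dec-true a? a)

⌊⌋-false : ∀ {A : Set} (a? : Dec A) → ¬ A → ⌊ a? ⌋ ≡ false
⌊⌋-false a? ¬a = trans (isYes≗does a?) (dec-false a? ¬a)

<⇒<ᵇ≡true : ∀ {m n} → m < n → (m <ᵇ n) ≡ true
<⇒<ᵇ≡true m<n = Equivalence.to T-≡ (<⇒<ᵇ m<n)

m+n<ᵇm≡false : ∀ m n → (m + n <ᵇ m) ≡ false
m+n<ᵇm≡false zero n = refl
m+n<ᵇm≡false (suc m) n = m+n<ᵇm≡false m n

m+n<ᵇm+o≡n<ᵇo : ∀ m n o → (m + n <ᵇ m + o) ≡ (n <ᵇ o)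
m+n<ᵇm+o≡n<ᵇo zero n o = refl
m+n<ᵇm+o≡n<ᵇo (suc m) n o = m+n<ᵇm+o≡n<ᵇo m n o

<-or-≡+ : ∀ a k → k < a ⊎ ∃ λ j → k ≡ a + j
<-or-≡+ a k with k <? a
... | yes k<a = inj₁ k<a
... | no k≮a = inj₂ (_ , sym (m+[n∸m]≡n (≮⇒≥ k≮a)))

-- Degrees and maximum degree as finite sums

∑-mono-≤ : ∀ {n} {f g : Fin n → ℕ} → (∀ i → f i ≤ g i) → ∑ f ≤ ∑ g
∑-mono-≤ {zero} f≤g = z≤n
∑-mono-≤ {suc n} f≤g = +-mono-≤ (f≤g zero) (∑-mono-≤ (f≤g ∘ suc))

∑-ind-true : ∀ {n} (b : Fin n → Bool) → (∀ i → b i ≡ true) → ∑ (ind ∘ b) ≡ n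
∑-ind-true {zero} b _ = refl
∑-ind-true {suc n} b b≡true rewrite b≡true zero = cong suc (∑-ind-true (b ∘ suc) (b≡true ∘ suc))

sumList-tabulate : ∀ {n} (f : Fin n → ℕ) → sumList (tabulate f) ≡ ∑ f
sumList-tabulate {zero} f = refl
sumList-tabulate {suc n} f = cong (f zero +_) (sumList-tabulate (f ∘ suc))

≤-foldr-⊔ : ∀ {n} (h : Fin n → ℕ) i → h i ≤ foldr _⊔_ 0 (tabulate h)
≤-foldr-⊔ h zero = m≤m⊔n _ _
≤-foldr-⊔ h (suc i) = ≤-trans (≤-foldr-⊔ (h ∘ suc) i) (m≤n⊔m _ _)

foldr-⊔-lub : ∀ {n D} (h : Fin n → ℕ) → (∀ i → h i ≤ D) → foldr _⊔_ 0 (tabulate h) ≤ D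
foldr-⊔-lub {zero} h _ = z≤n
foldr-⊔-lub {suc n} h h≤D = ⊔-lub (h≤D zero) (foldr-⊔-lub (h ∘ suc) (h≤D ∘ suc))

deg≡∑ : ∀ {n} (G : Graph n) u → deg G u ≡ ∑ (ind ∘ adj G u)
deg≡∑ G u = trans (cong sumList (map-tabulate id (ind ∘ adj G u))) (sumList-tabulate (ind ∘ adj G u))

maxDeg≡ : ∀ {n} (G : Graph n) → maxDeg G ≡ foldr _⊔_ 0 (tabulate (deg G))
maxDeg≡ G = cong (foldr _⊔_ 0) (map-tabulate id (deg G))

deg≤maxDeg : ∀ {n} (G : Graph n) x → deg G x ≤ maxDeg G
deg≤maxDeg G x = ≤-trans (≤-foldr-⊔ (deg G) x) (≤-reflexive (sym (maxDeg≡ G)))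

maxDeg-lub : ∀ {n D} (G : Graph n) → (∀ x → deg G x ≤ D) → maxDeg G ≤ D
maxDeg-lub G deg≤D = ≤-trans (≤-reflexive (maxDeg≡ G)) (foldr-⊔-lub (deg G) deg≤D)

deg-universal : ∀ {m} (H : Graph (suc m)) → (∀ y → adj H zero (suc y) ≡ true) → deg H zero ≡ m
deg-universal {m} H hub = begin
  deg H zero                                         ≡⟨ deg≡∑ H zero ⟩
  ind (adj H zero zero) + ∑ (ind ∘ adj H zero ∘ suc)
    ≡⟨ cong (λ b → ind b + ∑ (ind ∘ adj H zero ∘ suc)) (irrefl H zero) ⟩
  ∑ (ind ∘ adj H zero ∘ suc)                         ≡⟨ ∑-ind-true (adj H zero ∘ suc) hub ⟩
  m                                                  ∎
  where open ≡-Reasoning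

-- Degrees under a labeled contraction

adj-contract-inherited : ∀ {n} (K : Graph (suc n)) v u' x y →
  adj K (punchIn v x) (punchIn v y) ≡ true → adj (contract K v u') x y ≡ true
adj-contract-inherited K v u' x y xy rewrite xy = refl

adj-contract-absorbed : ∀ {n} (K : Graph (suc n)) v u' y → y ≢ u' →
  adj K v (punchIn v y) ≡ true → adj (contract K v u') u' y ≡ true
adj-contract-absorbed K v u' y y≢u' vy
  rewrite ⌊⌋-true (u' ≟ u') refl | ⌊⌋-false (y ≟ u') y≢u' | vy = ∨-zeroʳ (adj K (punchIn v u') (punchIn v y))

module _ {k} (K : Graph (suc (suc k))) (v : Fin (suc (suc k))) (u' : Fin (suc k)) where

  adj-contract-merged : ∀ y → y ≢ u' →
    ind (adj (contract K v u') u' y) ≤ ind (adj K (punchIn v u') (punchIn v y)) + ind (adj K v (punchIn v y))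
  adj-contract-merged y y≢u' rewrite ⌊⌋-true (u' ≟ u') refl | ⌊⌋-false (y ≟ u') y≢u' =
    ≤-trans (ind-∨ (adj K (punchIn v u') (punchIn v y)) (vy ∨ false))
            (≤-reflexive (cong (λ b → ind (adj K (punchIn v u') (punchIn v y)) + ind b) (∨-identityʳ vy)))
    where vy = adj K v (punchIn v y)

  adj-contract-away : ∀ x y → x ≢ u' → y ≢ u' →
    adj (contract K v u') x y ≡ adj K (punchIn v x) (punchIn v y)
  adj-contract-away x y x≢u' y≢u' rewrite ⌊⌋-false (x ≟ u') x≢u' | ⌊⌋-false (y ≟ u') y≢u' =
    ∨-identityʳ (adj K (punchIn v x) (punchIn v y))

  private
    u : Fin (suc (suc k))
    u = punchIn v u'

    deg≡remove-v-u : ∀ x → deg K x ≡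
      ind (adj K x v) + (ind (adj K x u) + ∑ (λ w → ind (adj K x (punchIn v (punchIn u' w)))))
    deg≡remove-v-u x = begin
      deg K x                                      ≡⟨ deg≡∑ K x ⟩
      ∑ (ind ∘ adj K x)                            ≡⟨ sum-remove {i = v} (ind ∘ adj K x) ⟩
      ind (adj K x v) + ∑ (ind ∘ adj K x ∘ punchIn v)
        ≡⟨ cong (ind (adj K x v) +_) (sum-remove {i = u'} (ind ∘ adj K x ∘ punchIn v)) ⟩
      ind (adj K x v) + (ind (adj K x u) + ∑ (λ w → ind (adj K x (punchIn v (punchIn u' w))))) ∎
      where open ≡-Reasoning

    deg≡remove-u' : ∀ y → deg (contract K v u') y ≡
      ind (adj (contract K v u') y u') + ∑ (λ w → ind (adj (contract K v u') y (punchIn u' w)))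
    deg≡remove-u' y = trans (deg≡∑ (contract K v u') y) (sum-remove {i = u'} (ind ∘ adj (contract K v u') y))

  deg-contract-merged : adj K u v ≡ true → deg (contract K v u') u' + 2 ≤ deg K u + deg K v
  deg-contract-merged uv = begin
    deg K/uv u' + 2
      ≡⟨ cong (_+ 2) (deg≡remove-u' u') ⟩
    ind (adj K/uv u' u') + ∑ (λ w → ind (adj K/uv u' (punchIn u' w))) + 2
      ≡⟨ cong (λ b → ind b + ∑ (λ w → ind (adj K/uv u' (punchIn u' w))) + 2) (irrefl K/uv u') ⟩
    ∑ (λ w → ind (adj K/uv u' (punchIn u' w))) + 2
      ≤⟨ +-monoˡ-≤ 2 (∑-mono-≤ (λ w → adj-contract-merged (punchIn u' w) (punchInᵢ≢i u' w))) ⟩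
    ∑ (λ w → A w + B w) + 2
      ≡⟨ cong (_+ 2) (∑-distrib-+ A B) ⟩
    ∑ A + ∑ B + 2
      ≡⟨ rearrange (∑ A) (∑ B) ⟩
    (1 + (0 + ∑ A)) + (0 + (1 + ∑ B))
      ≡⟨ sym (cong₂ _+_ deg-u deg-v) ⟩
    deg K u + deg K v ∎
    where
    open ≤-Reasoning
    K/uv = contract K v u'
    A B : Fin k → ℕ
    A w = ind (adj K u (punchIn v (punchIn u' w)))
    B w = ind (adj K v (punchIn v (punchIn u' w)))
    rearrange : ∀ a b → a + b + 2 ≡ (1 + (0 + a)) + (0 + (1 + b))
    rearrange = solve-∀
    deg-u : deg K u ≡ 1 + (0 + ∑ A)
    deg-u = trans (deg≡remove-v-u u) (cong₂ (λ p q → ind p + (ind q + ∑ A)) uv (irrefl K u))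
    deg-v : deg K v ≡ 0 + (1 + ∑ B)
    deg-v = trans (deg≡remove-v-u v)
                  (cong₂ (λ p q → ind p + (ind q + ∑ B)) (irrefl K v) (trans (Graph.sym K v u) uv))

  deg-contract-away : ∀ y → y ≢ u' → deg (contract K v u') y ≤ deg K (punchIn v y)
  deg-contract-away y y≢u' = begin
    deg K/uv y
      ≡⟨ deg≡remove-u' y ⟩
    ind (adj K/uv y u') + ∑ (λ w → ind (adj K/uv y (punchIn u' w)))
      ≡⟨ cong₂ (λ b s → ind b + s) (Graph.sym K/uv y u')
               (sum-cong-≗ (λ w → cong ind (adj-contract-away y (punchIn u' w) y≢u' (punchInᵢ≢i u' w)))) ⟩
    ind (adj K/uv u' y) + ∑ C
      ≤⟨ +-monoˡ-≤ (∑ C) (adj-contract-merged y y≢u') ⟩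
    ind (adj K u (punchIn v y)) + ind (adj K v (punchIn v y)) + ∑ C
      ≡⟨ cong₂ (λ p q → ind p + ind q + ∑ C) (Graph.sym K u (punchIn v y)) (Graph.sym K v (punchIn v y)) ⟩
    ind (adj K (punchIn v y) u) + ind (adj K (punchIn v y) v) + ∑ C
      ≡⟨ rearrange (ind (adj K (punchIn v y) u)) (ind (adj K (punchIn v y) v)) (∑ C) ⟩
    ind (adj K (punchIn v y) v) + (ind (adj K (punchIn v y) u) + ∑ C)
      ≡⟨ sym (deg≡remove-v-u (punchIn v y)) ⟩
    deg K (punchIn v y) ∎
    where
    open ≤-Reasoning
    K/uv = contract K v u'
    C : Fin k → ℕ
    C w = ind (adj K (punchIn v y) (punchIn v (punchIn u' w)))
    rearrange : ∀ a b c → a + b + c ≡ b + (a + c)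
    rearrange = solve-∀

-- The excess potential

excess : ℕ → ∀ {n} → Graph n → ℕ
excess D K = ∑ (λ x → deg K x ∸ D)

deg≤+excess : ∀ D {n} (K : Graph n) x → deg K x ≤ D + excess D K
deg≤+excess D {suc n} K x = begin
  deg K x                                    ≤⟨ m≤n+m∸n (deg K x) D ⟩
  D + (deg K x ∸ D)                          ≤⟨ +-monoʳ-≤ D (m≤m+n _ _) ⟩
  D + ((deg K x ∸ D) + ∑ (λ w → deg K (punchIn x w) ∸ D))
                                             ≡⟨ cong (D +_) (sym (sum-remove {i = x} (λ w → deg K w ∸ D))) ⟩
  D + excess D K                             ∎
  where open ≤-Reasoning

excess≡0 : ∀ D {n} (K : Graph n) → (∀ x → deg K x ≤ D) → excess D K ≡ 0
excess≡0 D {n} K deg≤D = trans (sum-cong-≗ (λ x → m≤n⇒m∸n≡0 (deg≤D x))) (sum-replicate-zero n)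

∸-merge : ∀ D x y z → x + 2 ≤ y + z → x ∸ D ≤ (y ∸ D) + (z ∸ D) + (D ∸ 2)
∸-merge D x y z x+2≤y+z = m≤n+o⇒m∸n≤o x D (+-cancelˡ-≤ 2 _ _ (begin
  2 + x                          ≡⟨ +-comm 2 x ⟩
  x + 2                          ≤⟨ x+2≤y+z ⟩
  y + z                          ≤⟨ +-mono-≤ (m≤n+m∸n y D) (m≤n+m∸n z D) ⟩
  (D + Y) + (D + Z)              ≤⟨ +-monoˡ-≤ (D + Z) (+-monoˡ-≤ Y (m≤n+m∸n D 2)) ⟩
  (2 + (D ∸ 2) + Y) + (D + Z)    ≡⟨ rearrange (D ∸ 2) D Y Z ⟩
  2 + (D + (Y + Z + (D ∸ 2)))    ∎))
  where
  open ≤-Reasoning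
  Y = y ∸ D
  Z = z ∸ D
  rearrange : ∀ e D Y Z → (2 + e + Y) + (D + Z) ≡ 2 + (D + (Y + Z + e))
  rearrange = solve-∀

excess-contract : ∀ D {n} (K : Graph (suc n)) v u' → adj K (punchIn v u') v ≡ true →
  excess D (contract K v u') ≤ excess D K + (D ∸ 2)
excess-contract D {suc k} K v u' uv = begin
  excess D K/uv
    ≡⟨ sum-remove {i = u'} (λ x → deg K/uv x ∸ D) ⟩
  (deg K/uv u' ∸ D) + ∑ (λ w → deg K/uv (punchIn u' w) ∸ D)
    ≤⟨ +-mono-≤ (∸-merge D (deg K/uv u') (deg K (punchIn v u')) (deg K v) (deg-contract-merged K v u' uv))
                (∑-mono-≤ (λ w → ∸-monoˡ-≤ D (deg-contract-away K v u' (punchIn u' w) (punchInᵢ≢i u' w)))) ⟩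
  (U + V + (D ∸ 2)) + ∑ rest
    ≡⟨ rearrange U V (D ∸ 2) (∑ rest) ⟩
  V + (U + ∑ rest) + (D ∸ 2)
    ≡⟨ cong (_+ (D ∸ 2)) (sym (trans (sum-remove {i = v} (λ x → deg K x ∸ D))
                                     (cong (V +_) (sum-remove {i = u'} (λ w → deg K (punchIn v w) ∸ D))))) ⟩
  excess D K + (D ∸ 2) ∎
  where
  open ≤-Reasoning
  K/uv = contract K v u'
  U = deg K (punchIn v u') ∸ D
  V = deg K v ∸ D
  rest : Fin k → ℕ
  rest w = deg K (punchIn v (punchIn u' w)) ∸ D
  rearrange : ∀ a b c s → (a + b + c) + s ≡ b + (a + s) + c
  rearrange = solve-∀

excess-Contractions : ∀ D {n m t} {K : Graph n} {H : Graph m} → Contractions K t H →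
  excess D H ≤ excess D K + t * (D ∸ 2)
excess-Contractions D {K = K} done = m≤m+n (excess D K) 0
excess-Contractions D {t = suc t} {K = K} {H} (step v u' uv K/uv⇝H) = begin
  excess D H                                     ≤⟨ excess-Contractions D K/uv⇝H ⟩
  excess D (contract K v u') + t * (D ∸ 2)       ≤⟨ +-monoˡ-≤ (t * (D ∸ 2)) (excess-contract D K v u' uv) ⟩
  excess D K + (D ∸ 2) + t * (D ∸ 2)             ≡⟨ +-assoc (excess D K) (D ∸ 2) (t * (D ∸ 2)) ⟩
  excess D K + suc t * (D ∸ 2)                   ∎
  where open ≤-Reasoning

maxDeg-Contractions : ∀ D {n m t} {G : Graph n} {H : Graph m} →
  maxDeg G ≤ D → Contractions G t H → maxDeg H ≤ D + t * (D ∸ 2)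
maxDeg-Contractions D {t = t} {G} {H} maxG≤D G⇝H = maxDeg-lub H λ x → begin
  deg H x                              ≤⟨ deg≤+excess D H x ⟩
  D + excess D H                       ≤⟨ +-monoʳ-≤ D (excess-Contractions D G⇝H) ⟩
  D + (excess D G + t * (D ∸ 2))       ≡⟨ cong (λ e → D + (e + t * (D ∸ 2))) excessG≡0 ⟩
  D + t * (D ∸ 2)                      ∎
  where
  open ≤-Reasoning
  excessG≡0 : excess D G ≡ 0
  excessG≡0 = excess≡0 D G λ x → ≤-trans (deg≤maxDeg G x) maxG≤D

maxDeg-Contractions⁻ : ∀ D {n m t} {G : Graph n} {H : Graph m} →
  Contractions G t H → D + t * (D ∸ 2) ≤ maxDeg H → D ≤ maxDeg G
maxDeg-Contractions⁻ D {t = t} {G} G⇝H bound≤maxH = ≮⇒≥ λ maxG<D → <⇒≱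
  (+-mono-<-≤ maxG<D (*-monoʳ-≤ t (∸-monoˡ-≤ 2 (<⇒≤ maxG<D))))
  (≤-trans bound≤maxH (maxDeg-Contractions (maxDeg G) ≤-refl G⇝H))

-- Counting on initial segments of ℕ

count : ∀ n {P : ℕ → Set} → Decidable P → ℕ
count n P? = ∑ (λ (i : Fin n) → ind (does (P? (toℕ i))))

count-+ : ∀ m n {P : ℕ → Set} (P? : Decidable P) → count (m + n) P? ≡ count m P? + count n (λ k → P? (m + k))
count-+ zero n P? = refl
count-+ (suc m) n P? = trans (cong (ind (does (P? 0)) +_) (count-+ m n (P? ∘ suc)))
                             (sym (+-assoc (ind (does (P? 0))) _ _))

ind-mono : ∀ {A B : Set} (a? : Dec A) (b? : Dec B) → (A → B) → ind (does a?) ≤ ind (does b?)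
ind-mono (yes a) b? f rewrite dec-true b? (f a) = ≤-refl
ind-mono (no _) b? f = z≤n

count-mono : ∀ n {P Q : ℕ → Set} (P? : Decidable P) (Q? : Decidable Q) →
  (∀ k → k < n → P k → Q k) → count n P? ≤ count n Q?
count-mono n P? Q? P⇒Q = ∑-mono-≤ λ i → ind-mono (P? (toℕ i)) (Q? (toℕ i)) (P⇒Q (toℕ i) (toℕ<n i))

count-none : ∀ n {P : ℕ → Set} (P? : Decidable P) → (∀ k → k < n → ¬ P k) → count n P? ≡ 0
count-none n P? ¬P = trans (sum-cong-≗ λ i → cong ind (dec-false (P? (toℕ i)) (¬P (toℕ i) (toℕ<n i))))
                           (sum-replicate-zero n)

count-all : ∀ n {P : ℕ → Set} (P? : Decidable P) → (∀ k → k < n → P k) → count n P? ≡ n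
count-all n P? P = ∑-ind-true (λ i → does (P? (toℕ i))) λ i → dec-true (P? (toℕ i)) (P (toℕ i) (toℕ<n i))

ind-⊎ : ∀ {A B C : Set} (a? : Dec A) (b? : Dec B) (c? : Dec C) → (A → B ⊎ C) →
  ind (does a?) ≤ ind (does b?) + ind (does c?)
ind-⊎ (no _) b? c? f = z≤n
ind-⊎ (yes a) b? c? f with f a
... | inj₁ b rewrite dec-true b? b = s≤s z≤n
... | inj₂ c rewrite dec-true c? c = m≤n+m 1 (ind (does b?))

count-⊎ : ∀ n {P Q R : ℕ → Set} (P? : Decidable P) (Q? : Decidable Q) (R? : Decidable R) →
  (∀ k → P k → Q k ⊎ R k) → count n P? ≤ count n Q? + count n R?
count-⊎ n P? Q? R? P⇒Q⊎R =
  ≤-trans (∑-mono-≤ {n} λ i → ind-⊎ (P? (toℕ i)) (Q? (toℕ i)) (R? (toℕ i)) (P⇒Q⊎R (toℕ i)))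
          (≤-reflexive (∑-distrib-+ {n} (λ i → ind (does (Q? (toℕ i)))) (λ i → ind (does (R? (toℕ i))))))

count-≤1 : ∀ n {P : ℕ → Set} (P? : Decidable P) {c} → (∀ k → k < n → P k → k ≡ c) → count n P? ≤ 1
count-≤1 zero P? uniq = z≤n
count-≤1 (suc n) P? uniq with P? 0
... | yes p = ≤-reflexive (cong suc (count-none n (P? ∘ suc)
                λ k k<n pk → 0≢1+n (trans (uniq 0 z<s p) (sym (uniq (suc k) (s<s k<n) pk)))))
... | no _ = count-≤1 n (P? ∘ suc) λ k k<n pk → cong pred (uniq (suc k) (s<s k<n) pk)

module Caterpillar (d : ℕ) where

  -- The caterpillar (t, a) lives on ℕ: the spine is 0, …, t and leaf ℓ is the vertex
  -- suc t + ℓ, hanging from spine vertex owner t a ℓ. The root owns the first a leaves,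
  -- each later spine vertex the next d, and the last one all remaining leaves.
  owner : ℕ → ℕ → ℕ → ℕ
  owner zero    a ℓ = 0
  owner (suc t) a ℓ = if ℓ <ᵇ a then 0 else suc (owner t d (ℓ ∸ a))

  owner-low : ∀ t a ℓ → ℓ < a → owner t a ℓ ≡ 0
  owner-low zero a ℓ ℓ<a = refl
  owner-low (suc t) a ℓ ℓ<a rewrite <⇒<ᵇ≡true ℓ<a = refl

  owner-high : ∀ t a k → owner (suc t) a (a + k) ≡ suc (owner t d k)
  owner-high t a k rewrite m+n<ᵇm≡false a k | m+n∸m≡n a k = refl

  owner-shift : ∀ t a b k → owner t (a + b) (a + k) ≡ owner t b k
  owner-shift zero a b k = refl
  owner-shift (suc t) a b k rewrite m+n<ᵇm+o≡n<ᵇo a k b | [m+n]∸[m+o]≡n∸o a k b = refl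

  owner-merge : ∀ t a ℓ → owner t (a + d) ℓ ≡ pred (owner (suc t) a ℓ)
  owner-merge t a ℓ with <-or-≡+ a ℓ
  ... | inj₁ ℓ<a = trans (owner-low t (a + d) ℓ (≤-trans ℓ<a (m≤m+n a d)))
                         (cong pred (sym (owner-low (suc t) a ℓ ℓ<a)))
  ... | inj₂ (k , refl) = trans (owner-shift t a d k) (cong pred (sym (owner-high t a k)))

  owner≤ : ∀ t a ℓ → owner t a ℓ ≤ t
  owner≤ zero a ℓ = z≤n
  owner≤ (suc t) a ℓ with ℓ <ᵇ a
  ... | true = z≤n
  ... | false = s≤s (owner≤ t d (ℓ ∸ a))

  parent : ℕ → ℕ → ℕ → ℕ
  parent t a k = if k <ᵇ suc t then pred k else owner t a (k ∸ suc t)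

  parent-spine : ∀ t a k → k < suc t → parent t a k ≡ pred k
  parent-spine t a k k≤t rewrite <⇒<ᵇ≡true k≤t = refl

  parent-leaf : ∀ t a ℓ → parent t a (suc t + ℓ) ≡ owner t a ℓ
  parent-leaf t a ℓ rewrite m+n<ᵇm≡false (suc t) ℓ | m+n∸m≡n (suc t) ℓ = refl

  parent< : ∀ t a k → 0 < k → parent t a k < k
  parent< t a (suc k) _ with <-or-≡+ (suc t) (suc k)
  ... | inj₁ k≤t = ≤-reflexive (cong suc (parent-spine t a (suc k) k≤t))
  ... | inj₂ (ℓ , eq) = begin-strict
    parent t a (suc k)       ≡⟨ cong (parent t a) eq ⟩
    parent t a (suc t + ℓ)   ≡⟨ parent-leaf t a ℓ ⟩
    owner t a ℓ              ≤⟨ owner≤ t a ℓ ⟩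
    t                        <⟨ n<1+n t ⟩
    suc t                    ≤⟨ m≤m+n (suc t) ℓ ⟩
    suc t + ℓ                ≡⟨ sym eq ⟩
    suc k                    ∎
    where open ≤-Reasoning

  parent-merge : ∀ t a k → parent t (a + d) k ≡ pred (parent (suc t) a (suc k))
  parent-merge t a k with <-or-≡+ (suc t) k
  ... | inj₁ k≤t = trans (parent-spine t (a + d) k k≤t)
                         (cong pred (sym (parent-spine (suc t) a (suc k) (s<s k≤t))))
  ... | inj₂ (ℓ , refl) = trans (parent-leaf t (a + d) ℓ)
                                (trans (owner-merge t a ℓ) (cong pred (sym (parent-leaf (suc t) a ℓ))))

  IsParent : ℕ → ℕ → ℕ → ℕ → Set
  IsParent t a x k = 0 < k × parent t a k ≡ x

  IsParent? : ∀ t a x → Decidable (IsParent t a x)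
  IsParent? t a x k = (0 <? k) ×-dec (parent t a k ≟ℕ x)

  Edge : ℕ → ℕ → ℕ → ℕ → Set
  Edge t a x y = IsParent t a x y ⊎ IsParent t a y x

  Edge? : ∀ t a x → Decidable (Edge t a x)
  Edge? t a x y = IsParent? t a x y ⊎-dec IsParent? t a y x

  Edge-irrefl : ∀ t a x → ¬ Edge t a x x
  Edge-irrefl t a x = [ no-loop , no-loop ]
    where
    no-loop : ¬ IsParent t a x x
    no-loop (0<x , x↦x) = <-irrefl x↦x (parent< t a x 0<x)

  caterpillar : ℕ → ℕ → (n : ℕ) → Graph n
  caterpillar t a n = record
    { adj    = λ x y → does (Edge? t a (toℕ x) (toℕ y))
    ; sym    = λ x y → does-⇔ (mk⇔ swap swap) (Edge? t a (toℕ x) (toℕ y)) (Edge? t a (toℕ y) (toℕ x))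
    ; irrefl = λ x → dec-false (Edge? t a (toℕ x) (toℕ x)) (Edge-irrefl t a (toℕ x))
    }

  -- Contracting the root into vertex 1 yields the caterpillar (t − 1, a + d) plus possibly
  -- more edges; containment is all that is tracked, the upper bound supplies the rest.
  Contains : ℕ → ℕ → ∀ {n} → Graph n → Set
  Contains t a K = ∀ x y → IsParent t a (toℕ x) (toℕ y) → adj K x y ≡ true

  caterpillar-contains : ∀ t a n → Contains t a (caterpillar t a n)
  caterpillar-contains t a n x y x↦y = dec-true (Edge? t a (toℕ x) (toℕ y)) (inj₁ x↦y)

  contract-contains : ∀ t a {n} (K : Graph (suc (suc n))) →
    Contains (suc t) a K → Contains t (a + d) (contract K zero zero)
  contract-contains t a K K⊇ x y (0<y , y↦x) =
    via (parent (suc t) a (suc (toℕ y))) x refl (trans (sym y↦x) (parent-merge t a (toℕ y)))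
    where
    y≢0 : y ≢ zero
    y≢0 refl = <-irrefl refl 0<y
    via : ∀ p x → parent (suc t) a (suc (toℕ y)) ≡ p → toℕ x ≡ pred p → adj (contract K zero zero) x y ≡ true
    via zero zero sy↦0 _ = adj-contract-absorbed K zero zero y y≢0 (K⊇ zero (suc y) (z<s , sy↦0))
    via (suc p) x sy↦sp x≡p = adj-contract-inherited K zero zero x y
      (K⊇ (suc x) (suc y) (z<s , trans sy↦sp (cong suc (sym x≡p))))

  contract-caterpillar : ∀ t a m (K : Graph (suc (t + m))) → Contains t a K →
    Σ (Graph (suc m)) λ H → Contractions K t H × (∀ y → adj H zero (suc y) ≡ true)
  contract-caterpillar zero a m K K⊇ = K , done , λ y → K⊇ zero (suc y) (z<s , refl)
  contract-caterpillar (suc t) a m K K⊇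
    with contract-caterpillar t (a + d) m (contract K zero zero) (contract-contains t a K K⊇)
  ... | H , K/uv⇝H , hub = H , step zero zero edge-1-0 K/uv⇝H , hub
    where
    edge-1-0 : adj K (suc zero) zero ≡ true
    edge-1-0 = trans (Graph.sym K (suc zero) zero) (K⊇ zero (suc zero) (z<s , refl))

  owned : ℕ → ℕ → ℕ → ℕ → ℕ
  owned t a X L = count L (λ ℓ → owner t a ℓ ≟ℕ X)

  budget : ℕ → ℕ → ℕ
  budget a zero    = suc a
  budget a (suc _) = suc d

  budget≤ : ∀ X → budget d X ≤ suc d
  budget≤ zero    = ≤-refl
  budget≤ (suc _) = ≤-refl

  owned-split : ∀ t a X → owned (suc t) a X (a + (d + t * d) + 1) ≡
    owned (suc t) a X a + count (d + t * d + 1) (λ k → owner (suc t) a (a + k) ≟ℕ X)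
  owned-split t a X = trans (cong (owned (suc t) a X) (+-assoc a (d + t * d) 1))
                            (count-+ a (d + t * d + 1) (λ ℓ → owner (suc t) a ℓ ≟ℕ X))

  owned-budget : ∀ t a X → ind (X <ᵇ t) + owned t a X (a + t * d + 1) ≤ budget a X
  owned-budget zero a zero =
    ≤-reflexive (trans (count-all (a + 0 + 1) (λ ℓ → owner 0 a ℓ ≟ℕ 0) (λ _ _ → refl)) (eq a))
    where
    eq : ∀ a → a + 0 + 1 ≡ suc a
    eq = solve-∀
  owned-budget zero a (suc X) =
    ≤-trans (≤-reflexive (count-none (a + 0 + 1) (λ ℓ → owner 0 a ℓ ≟ℕ suc X) (λ _ _ ()))) z≤n
  owned-budget (suc t) a zero = begin
    1 + owned (suc t) a 0 (a + (d + t * d) + 1)     ≡⟨ cong (1 +_) (owned-split t a 0) ⟩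
    1 + (owned (suc t) a 0 a + count R high)        ≡⟨ cong₂ (λ m n → 1 + (m + n)) root-block beyond-root ⟩
    1 + (a + 0)                                     ≡⟨ cong suc (+-identityʳ a) ⟩
    suc a                                           ∎
    where
    open ≤-Reasoning
    R = d + t * d + 1
    high = λ k → owner (suc t) a (a + k) ≟ℕ 0
    root-block : owned (suc t) a 0 a ≡ a
    root-block = count-all a (λ ℓ → owner (suc t) a ℓ ≟ℕ 0) (owner-low (suc t) a)
    beyond-root : count R high ≡ 0
    beyond-root = count-none R high λ k _ → 1+n≢0 ∘ trans (sym (owner-high t a k))
  owned-budget (suc t) a (suc j) = begin
    ind (j <ᵇ t) + owned (suc t) a (suc j) (a + (d + t * d) + 1)
      ≡⟨ cong (ind (j <ᵇ t) +_) (owned-split t a (suc j)) ⟩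
    ind (j <ᵇ t) + (owned (suc t) a (suc j) a + count R high)
      ≡⟨ cong (λ m → ind (j <ᵇ t) + (m + count R high)) root-block ⟩
    ind (j <ᵇ t) + count R high
      ≤⟨ +-monoʳ-≤ (ind (j <ᵇ t)) beyond-root ⟩
    ind (j <ᵇ t) + owned t d j R                    ≤⟨ owned-budget t d j ⟩
    budget d j                                      ≤⟨ budget≤ j ⟩
    suc d                                           ∎
    where
    open ≤-Reasoning
    R = d + t * d + 1
    high = λ k → owner (suc t) a (a + k) ≟ℕ suc j
    root-block : owned (suc t) a (suc j) a ≡ 0
    root-block = count-none a (λ ℓ → owner (suc t) a ℓ ≟ℕ suc j)
                   λ ℓ ℓ<a → 0≢1+n ∘ trans (sym (owner-low (suc t) a ℓ ℓ<a))
    beyond-root : count R high ≤ owned t d j R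
    beyond-root = count-mono R high (λ k → owner t d k ≟ℕ j)
                    λ k _ → suc-injective ∘ trans (sym (owner-high t a k))

  spine-child : ∀ t a X k → k < suc t → IsParent t a X k → k ≡ suc X
  spine-child t a X (suc k) k≤t (_ , k↦X) = cong suc (trans (sym (parent-spine t a (suc k) k≤t)) k↦X)

  spine-children : ∀ t a X → count (suc t) (IsParent? t a X) ≤ ind (X <ᵇ t)
  spine-children t a X with X <ᵇ t in X<ᵇt
  ... | true = count-≤1 (suc t) (IsParent? t a X) (spine-child t a X)
  ... | false = ≤-reflexive (count-none (suc t) (IsParent? t a X) λ k k≤t k↦X →
                  subst T X<ᵇt (<⇒<ᵇ (s<s⁻¹ (subst (_< suc t) (spine-child t a X k k≤t k↦X) k≤t))))

  children-bound : ∀ t a X → count (suc t + (a + t * d + 1)) (IsParent? t a X) ≤ budget a X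
  children-bound t a X = begin
    count (suc t + L) (IsParent? t a X)
      ≡⟨ count-+ (suc t) L (IsParent? t a X) ⟩
    count (suc t) (IsParent? t a X) + count L (λ ℓ → IsParent? t a X (suc t + ℓ))
      ≤⟨ +-mono-≤ (spine-children t a X)
                  (count-mono L (λ ℓ → IsParent? t a X (suc t + ℓ)) (λ ℓ → owner t a ℓ ≟ℕ X)
                     λ ℓ _ (_ , ℓ↦X) → trans (sym (parent-leaf t a ℓ)) ℓ↦X) ⟩
    ind (X <ᵇ t) + owned t a X L
      ≤⟨ owned-budget t a X ⟩
    budget a X ∎
    where
    open ≤-Reasoning
    L = a + t * d + 1

  parents≤1 : ∀ t a n X → count n (λ k → IsParent? t a k X) ≤ 1
  parents≤1 t a n X = count-≤1 n (λ k → IsParent? t a k X) λ k _ (_ , X↦k) → sym X↦k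

  root-parentless : ∀ t a n → count n (λ k → IsParent? t a k 0) ≡ 0
  root-parentless t a n = count-none n (λ k → IsParent? t a k 0) λ _ _ ()

  degree-bound : ∀ t X → count (suc t + (suc d + t * d + 1)) (Edge? t (suc d) X) ≤ 2 + d
  degree-bound t X = begin
    count N (Edge? t (suc d) X)
      ≤⟨ count-⊎ N (Edge? t (suc d) X) (IsParent? t (suc d) X) (λ k → IsParent? t (suc d) k X)
                 (λ _ e → e) ⟩
    count N (IsParent? t (suc d) X) + count N (λ k → IsParent? t (suc d) k X)
      ≤⟨ +-monoˡ-≤ _ (children-bound t (suc d) X) ⟩
    budget (suc d) X + count N (λ k → IsParent? t (suc d) k X)
      ≤⟨ by-root X ⟩
    2 + d ∎
    where
    open ≤-Reasoning
    N = suc t + (suc d + t * d + 1)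
    by-root : ∀ X → budget (suc d) X + count N (λ k → IsParent? t (suc d) k X) ≤ 2 + d
    by-root zero = ≤-reflexive (trans (cong (2 + d +_) (root-parentless t (suc d) N)) (+-identityʳ (2 + d)))
    by-root (suc j) = ≤-trans (+-monoʳ-≤ (suc d) (parents≤1 t (suc d) N (suc j)))
                              (≤-reflexive (+-comm (suc d) 1))

  leaves : ℕ → ℕ
  leaves t = suc d + t * d + 1

  example : (t : ℕ) → Graph (suc t + leaves t)
  example t = caterpillar t (suc d) (suc t + leaves t)

  maxDeg-example≤ : ∀ t → maxDeg (example t) ≤ 2 + d
  maxDeg-example≤ t = maxDeg-lub (example t) λ x →
    ≤-trans (≤-reflexive (deg≡∑ (example t) x)) (degree-bound t (toℕ x))

  tight : ∀ t → Σ ℕ λ n → Σ (Graph n) λ G → Σ ℕ λ m → Σ (Graph m) λ H →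
    maxDeg G ≡ 2 + d × Contractions G t H × maxDeg H ≡ 2 + d + t * d
  tight t with contract-caterpillar t (suc d) (leaves t) (example t) (caterpillar-contains t (suc d) _)
  ... | H , G⇝H , hub = _ , example t , _ , H , maxG , G⇝H , maxH
    where
    leaves≡ : ∀ d e → suc d + e + 1 ≡ 2 + d + e
    leaves≡ = solve-∀
    maxH : maxDeg H ≡ 2 + d + t * d
    maxH = ≤-antisym (maxDeg-Contractions (2 + d) (maxDeg-example≤ t) G⇝H) (begin
      2 + d + t * d    ≡⟨ sym (leaves≡ d (t * d)) ⟩
      leaves t         ≡⟨ sym (deg-universal H hub) ⟩
      deg H zero       ≤⟨ deg≤maxDeg H zero ⟩
      maxDeg H         ∎)
      where open ≤-Reasoning
    maxG : maxDeg (example t) ≡ 2 + d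
    maxG = ≤-antisym (maxDeg-example≤ t) (maxDeg-Contractions⁻ (2 + d) G⇝H (≤-reflexive (sym maxH)))

-- The bound itself holds for every Δ; 2 ≤ Δ is needed only for tightness.
lemma10 : ((Δ : ℕ) → 2 ≤ Δ → ∀ {n} (G : Graph n) → maxDeg G ≡ Δ →
              (t : ℕ) → ∀ {m} (H : Graph m) → Contractions G t H →
              maxDeg H ≤ Δ + t * (Δ ∸ 2))
            × ((Δ : ℕ) → 2 ≤ Δ → (t : ℕ) →
              Σ ℕ λ n → Σ (Graph n) λ G → Σ ℕ λ m → Σ (Graph m) λ H →
                maxDeg G ≡ Δ × Contractions G t H × maxDeg H ≡ Δ + t * (Δ ∸ 2))
lemma10 = (λ Δ _ G maxG≡Δ t H G⇝H → maxDeg-Contractions Δ (≤-reflexive maxG≡Δ) G⇝H)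
        , λ { (suc (suc d)) (s≤s (s≤s z≤n)) → Caterpillar.tight d }
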